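{- Let $\alpha$ be a composition, $n\ge1$, and $\beta$ a composition with $\alpha<_c\beta$ such that $\beta/\!\!/\alpha$ is an nc border strip of size $n$. If $w\in CRHW_n$ satisfies $w(\alpha)=\beta$ and $j\in E(\beta/\!\!/\alpha)$, then $j\in\mathrm{leg}(w)$.
   Context: A composition is a finite sequence $\alpha=(\alpha_1,\ldots,\alpha_k)$ of positive integers; $l(\alpha)=k$, $|\alpha|=\sum\alpha_i$; its diagram is the set of boxes $(i,j)$ with $1\le i\le k$, $1\le j\le\alpha_i$ (rows top to bottom). Write $\alpha\lessdot_c\beta$ if $\beta=(1,\alpha_1,\ldots,\alpha_k)$, or $\beta$ is obtained from $\alpha$ by increasing a part $\alpha_m$ by one where $\alpha_i\ne\alpha_m$ for all $i<m$; $<_c$ is the transitive closure. If $\alpha<_c\beta$ and $d=l(\beta)-l(\alpha)$, $\beta/\!\!/\alpha$ is the set of boxes of the diagram of $\beta$ not of the form $(i'+d,j)$ with $j\le\alpha_{i'}$; its size is $|\beta|-|\alpha|$; it is an interval shape if the set of columns containing its boxes is a set of consecutive integers. An interval shape is an nc border strip if (1) whenever $(i,1),(i,2)\in\beta/\!\!/\alpha$, $(i,1)$ is the bottommost box of column 1 of $\beta/\!\!/\alpha$; (2) whenever $(i,j),(i,j+1)\in\beta/\!\!/\alpha$ with $j\ge2$, $(i,j)$ is the topmost box of column $j$ of $\beta/\!\!/\alpha$. $E(\beta/\!\!/\alpha)$ is the set of $j$ such that $(i,j),(i,j+1)\in\beta/\!\!/\alpha$ for some $i$. Box-adding operators: $\mathfrak{t}_1(\alpha)=(1,\alpha_1,\ldots,\alpha_k)$;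 for $i\ge2$, $\mathfrak{t}_i(\alpha)$ increases by one the leftmost part equal to $i-1$ if one exists, else is $0$; $\mathfrak{t}_i(0)=0$. A word $w=\mathfrak{t}_{i_1}\cdots\mathfrak{t}_{i_n}$ acts by $w(\alpha)=\mathfrak{t}_{i_1}(\cdots\mathfrak{t}_{i_n}(\alpha)\cdots)$. For $0\le k\le n-1$ it is a reverse $k$-hookword if $i_1\le\cdots\le i_{k+1}>i_{k+2}>\cdots>i_n$; then $\mathrm{leg}(w)=\{i_{k+1},\ldots,i_n\}$. It is connected if $\{i_1,\ldots,i_n\}$ is a set of consecutive integers; $CRHW_n$ is the set of connected reverse hookwords of length $n$. -}

module Defs where

open import Data.Nat using (ℕ; zero; suc; _+_; _∸_; _≤_; _<_; _>_)
open import Data.Nat.Properties using (_≟_)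
open import Data.List using (List; []; _∷_; length; drop)
open import Data.Nat.ListAction using (sum)
open import Data.List.Relation.Unary.All using (All)
open import Data.List.Membership.Propositional using (_∈_)
open import Data.Maybe using (Maybe; just; nothing; _>>=_)
open import Data.Product using (Σ; ∃; _×_)
open import Data.Sum using (_⊎_)
open import Relation.Nullary using (¬_; yes; no)
open import Relation.Binary.PropositionalEquality using (_≡_; _≢_)
open import Relation.Binary.Construct.Closure.Transitive using (TransClosure)

IsComposition : List ℕ → Set
IsComposition α = All (λ x → 1 ≤ x) α

-- 0-based lookup with default 0: nth α i = α_{i+1}.
nth : List ℕ → ℕ → ℕ
nth []       _       = 0
nth (x ∷ xs) zero    = x
nth (x ∷ xs) (suc i) = nth xs i

incAt : List ℕ → ℕ → List ℕ
incAt []       _       = []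
incAt (x ∷ xs) zero    = suc x ∷ xs
incAt (x ∷ xs) (suc m) = x ∷ incAt xs m

_⋖c_ : List ℕ → List ℕ → Set
α ⋖c β = (β ≡ 1 ∷ α)
       ⊎ Σ ℕ (λ m → m < length α × (∀ i → i < m → nth α i ≢ nth α m) × β ≡ incAt α m)

_<c_ : List ℕ → List ℕ → Set
_<c_ = TransClosure _⋖c_

-- boxes (i , j), 1-indexed: row i, column j
InDiag : List ℕ → ℕ → ℕ → Set
InDiag α i j = 1 ≤ i × i ≤ length α × 1 ≤ j × j ≤ nth α (i ∸ 1)

InSkew : List ℕ → List ℕ → ℕ → ℕ → Set
InSkew β α i j =
  InDiag β i j × ¬ (Σ ℕ λ i' → i ≡ i' + (length β ∸ length α) × InDiag α i' j)

ColOcc : List ℕ → List ℕ → ℕ → Set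
ColOcc β α j = Σ ℕ λ i → InSkew β α i j

IsIntervalShape : List ℕ → List ℕ → Set
IsIntervalShape β α =
  ∀ j₁ j₂ j → ColOcc β α j₁ → ColOcc β α j₂ → j₁ ≤ j → j ≤ j₂ → ColOcc β α j

IsNCBorderStrip : List ℕ → List ℕ → Set
IsNCBorderStrip β α =
  IsIntervalShape β α
  × (∀ i → InSkew β α i 1 → InSkew β α i 2 → ∀ i' → InSkew β α i' 1 → i' ≤ i)
  × (∀ i j → 2 ≤ j → InSkew β α i j → InSkew β α i (suc j) →
       ∀ i' → InSkew β α i' j → i ≤ i')

InE : List ℕ → List ℕ → ℕ → Set
InE β α j = Σ ℕ λ i → InSkew β α i j × InSkew β α i (suc j)

skewSize : List ℕ → List ℕ → ℕ
skewSize β α = sum β ∸ sum α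

-- leftmost part equal to v increased by one, or nothing (= 0)
incLeftmost : ℕ → List ℕ → Maybe (List ℕ)
incLeftmost v []       = nothing
incLeftmost v (x ∷ xs) with x ≟ v
... | yes _ = just (suc x ∷ xs)
... | no  _ = Data.Maybe.map (x ∷_) (incLeftmost v xs)

-- box-adding operator t_i (t_0 is not used; set to 0)
𝔱 : ℕ → Maybe (List ℕ) → Maybe (List ℕ)
𝔱 _ nothing = nothing
𝔱 zero (just α) = nothing
𝔱 (suc zero) (just α) = just (1 ∷ α)
𝔱 (suc (suc v)) (just α) = incLeftmost (suc v) α

-- word w = t_{i₁} ⋯ t_{iₙ} (as the list i₁ … iₙ) acting on α
act : List ℕ → List ℕ → Maybe (List ℕ)
act []      α = just α
act (i ∷ w) α = 𝔱 i (act w α)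

-- reverse k-hookword: i₁ ≤ ⋯ ≤ i_{k+1} > i_{k+2} > ⋯ > iₙ  (0-based: nth w a = i_{a+1})
IsRevHookword : ℕ → List ℕ → Set
IsRevHookword k w =
  k < length w
  × (∀ a → a < k → nth w a ≤ nth w (suc a))
  × (∀ a → k ≤ a → suc a < length w → nth w a > nth w (suc a))

InLeg : ℕ → List ℕ → ℕ → Set
InLeg k w j = j ∈ drop k w

IsConnected : List ℕ → Set
IsConnected w = ∀ a b c → a ∈ w → b ∈ w → a ≤ c → c ≤ b → c ∈ w

IsCRHW : ℕ → ℕ → List ℕ → Set
IsCRHW n k w = All (λ x → 1 ≤ x) w × length w ≡ n × IsRevHookword k w × IsConnected w

-- Each operator adds one box, in column c for 𝔱 c, at the end of its row. So a row of β // α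
-- can only contain boxes in both columns j and j + 1 if some 𝔱 (j + 1) acts after some 𝔱 j,
-- i.e. if the letter j occurs to the right of an occurrence of j + 1 in w. In a reverse
-- hookword the arm is weakly increasing, so a letter j right of a letter j + 1 lies in the leg.
module Submission where

open import Defs
open import Data.Nat using (ℕ; zero; suc; _+_; _∸_; _≤_; _<_; z≤n; s≤s)
open import Data.Nat.Properties
  using (_≟_; ≤-refl; ≤-trans; ≤-antisym; ≤-pred; ≤∧≢⇒<; +-suc; +-identityʳ; n∸n≡0; +-∸-assoc; 1+n≰n; 1+n≢n; m≤n⇒m≤1+n)
open import Data.List using (List; []; _∷_; length; drop)
open import Data.List.Relation.Unary.Any using (here; there)
open import Data.List.Membership.Propositional using (_∈_; _∉_)
open import Data.List.Membership.DecPropositional _≟_ using (_∈?_)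
open import Data.Maybe using (just; nothing)
open import Data.Product using (Σ; _×_; _,_; proj₁; proj₂)
open import Data.Sum using (_⊎_; inj₁; inj₂)
open import Data.Unit using (⊤; tt)
open import Data.Empty using (⊥; ⊥-elim)
open import Relation.Nullary using (¬_; yes; no)
open import Relation.Binary.PropositionalEquality using (_≡_; _≢_; refl; sym; trans; cong; subst)

incLeftmost-spec : ∀ v β β' → incLeftmost v β ≡ just β' →
  Σ ℕ λ m → length β' ≡ length β × nth β m ≡ v × nth β' m ≡ suc v
          × (∀ x → x ≢ m → nth β' x ≡ nth β x)
incLeftmost-spec v [] β' ()
incLeftmost-spec v (x ∷ xs) β' eq with x ≟ v
incLeftmost-spec v (x ∷ xs) β' refl | yes refl =
  0 , refl , refl , refl , λ { zero 0≢0 → ⊥-elim (0≢0 refl) ; (suc y) _ → refl }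
incLeftmost-spec v (x ∷ xs) β' eq | no _ with incLeftmost v xs in e
incLeftmost-spec v (x ∷ xs) β' refl | no _ | just ys with incLeftmost-spec v xs ys e
... | m , len , old , new , same =
  suc m , cong suc len , old , new , λ { zero _ → refl ; (suc y) y≢m → same y (λ p → y≢m (cong suc p)) }
incLeftmost-spec v (x ∷ xs) β' () | no _ | nothing

InSkew-self : ∀ α i col → ¬ InSkew α α i col
InSkew-self α i col (d , notShifted) =
  notShifted (i , sym (trans (cong (i +_) (n∸n≡0 (length α))) (+-identityʳ i)) , d)

InSkew-transfer : ∀ {α β β' i col} → length β' ≡ length β →
  InSkew β' α i col → InDiag β i col → InSkew β α i col
InSkew-transfer {α} {i = i} len (_ , notShifted) d =
  d , λ { (i' , e , d') → notShifted (i' , subst (λ L → i ≡ i' + (L ∸ length α)) (sym len) e , d') }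

record SkewGrowth (α : List ℕ) (c : ℕ) (β β' : List ℕ) : Set where
  constructor skewGrowth
  field
    row    : ℕ → ℕ
    growth : ∀ i col → InSkew β' α i col → InSkew β α (row i) col ⊎ (col ≡ c × nth β' (i ∸ 1) ≡ c)

-- Since w acts from the right, this says that 𝔱 (suc j) never acts after 𝔱 j.
NoLetterRightOfSuc : ℕ → List ℕ → Set
NoLetterRightOfSuc j [] = ⊤
NoLetterRightOfSuc j (c ∷ w) = (c ≡ suc j → j ∉ w) × NoLetterRightOfSuc j w

module _ {α : List ℕ} where

  𝔱-skewGrowth : ∀ c β β' → 𝔱 c (just β) ≡ just β' → length α ≤ length β →
    SkewGrowth α c β β' × length α ≤ length β'
  𝔱-skewGrowth zero β β' ()
  𝔱-skewGrowth (suc zero) β .(1 ∷ β) refl α≤β = skewGrowth (λ i → i ∸ 1) growth , m≤n⇒m≤1+n α≤β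
    where
    shift : ∀ i' {i} → i ≡ i' + (length β ∸ length α) → suc i ≡ i' + (length (1 ∷ β) ∸ length α)
    shift i' e = trans (cong suc e) (trans (sym (+-suc i' _)) (cong (i' +_) (sym (+-∸-assoc 1 α≤β))))
    growth : ∀ i col → InSkew (1 ∷ β) α i col →
      InSkew β α (i ∸ 1) col ⊎ (col ≡ 1 × nth (1 ∷ β) (i ∸ 1) ≡ 1)
    growth zero col ((() , _) , _)
    growth (suc zero) col ((_ , _ , 1≤col , col≤1) , _) = inj₂ (≤-antisym col≤1 1≤col , refl)
    growth (suc (suc i)) col ((_ , s≤s i<β , 1≤col , col≤) , notShifted) =
      inj₁ ((s≤s z≤n , i<β , 1≤col , col≤) , λ { (i' , e , d) → notShifted (i' , shift i' e , d) })
  𝔱-skewGrowth (suc (suc v)) β β' eq α≤β with incLeftmost-spec (suc v) β β' eq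
  ... | m , len , old , new , same = skewGrowth (λ i → i) growth , subst (length α ≤_) (sym len) α≤β
    where
    rowBound : ∀ i col → col ≤ nth β' (i ∸ 1) →
      col ≤ nth β (i ∸ 1) ⊎ (col ≡ suc (suc v) × nth β' (i ∸ 1) ≡ suc (suc v))
    rowBound i col col≤ with (i ∸ 1) ≟ m
    ... | no i≢m = inj₁ (subst (col ≤_) (same (i ∸ 1) i≢m) col≤)
    ... | yes refl with col ≟ suc (suc v)
    ...   | yes col≡c = inj₂ (col≡c , new)
    ...   | no col≢c = inj₁ (subst (col ≤_) (sym old) (≤-pred (≤∧≢⇒< (subst (col ≤_) new col≤) col≢c)))
    growth : ∀ i col → InSkew β' α i col → InSkew β α i col ⊎ (col ≡ suc (suc v) × nth β' (i ∸ 1) ≡ suc (suc v))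
    growth i col s@((1≤i , i≤β' , 1≤col , col≤) , _) with rowBound i col col≤
    ... | inj₁ col≤β = inj₁ (InSkew-transfer {α} {β} {β'} len s (1≤i , subst (i ≤_) len i≤β' , 1≤col , col≤β))
    ... | inj₂ newBox = inj₂ newBox

  act-length : ∀ w β → act w α ≡ just β → length α ≤ length β
  act-length [] β refl = ≤-refl
  act-length (c ∷ w) β e with act w α in ew
  ... | just γ = proj₂ (𝔱-skewGrowth c γ β e (act-length w γ ew))

  act-∷-skewGrowth : ∀ c w β → act (c ∷ w) α ≡ just β →
    Σ (List ℕ) λ γ → act w α ≡ just γ × SkewGrowth α c γ β
  act-∷-skewGrowth c w β e with act w α in ew
  ... | just γ = γ , refl , proj₁ (𝔱-skewGrowth c γ β e (act-length w γ ew))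

  module _ (j : ℕ) where

    NoBoxInColumn : List ℕ → Set
    NoBoxInColumn β = ∀ i → ¬ InSkew β α i j

    skewGrowth-NoBoxInColumn : ∀ {c β β'} → SkewGrowth α c β β' → c ≢ j →
      NoBoxInColumn β → NoBoxInColumn β'
    skewGrowth-NoBoxInColumn (skewGrowth f growth) c≢j none i s with growth i j s
    ... | inj₁ s' = none (f i) s'
    ... | inj₂ (j≡c , _) = c≢j (sym j≡c)

    -- A new box in column j ends its row, so its row has no box in column j + 1.
    skewGrowth-¬InE : ∀ {c β β'} → SkewGrowth α c β β' → c ≢ suc j →
      ¬ InE β α j → ¬ InE β' α j
    skewGrowth-¬InE (skewGrowth f growth) c≢j+1 ¬E (i , s , s₊) with growth i (suc j) s₊
    ... | inj₂ (j+1≡c , _) = c≢j+1 (sym j+1≡c)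
    ... | inj₁ s₊' with growth i j s
    ...   | inj₁ s' = ¬E (f i , s' , s₊')
    ...   | inj₂ (refl , rowEnd) = 1+n≰n (subst (suc j ≤_) rowEnd (proj₂ (proj₂ (proj₂ (proj₁ s₊)))))

    NoBoxInColumn⇒¬InE : ∀ {β} → NoBoxInColumn β → ¬ InE β α j
    NoBoxInColumn⇒¬InE none (i , s , _) = none i s

    act-NoBoxInColumn : ∀ w β → act w α ≡ just β → j ∉ w → NoBoxInColumn β
    act-NoBoxInColumn [] β refl _ i = InSkew-self α i j
    act-NoBoxInColumn (c ∷ w) β e j∉ with act-∷-skewGrowth c w β e
    ... | γ , eγ , grow = skewGrowth-NoBoxInColumn grow (λ c≡j → j∉ (here (sym c≡j)))
                            (act-NoBoxInColumn w γ eγ (λ j∈ → j∉ (there j∈)))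

    act-¬InE : ∀ w β → act w α ≡ just β → NoLetterRightOfSuc j w → ¬ InE β α j
    act-¬InE [] β refl _ = NoBoxInColumn⇒¬InE {α} (λ i → InSkew-self α i j)
    act-¬InE (c ∷ w) β e (c⇒j∉ , ok) with act-∷-skewGrowth c w β e | c ≟ suc j
    ... | γ , eγ , grow | yes c≡j+1 =
      NoBoxInColumn⇒¬InE {β} (skewGrowth-NoBoxInColumn grow (λ c≡j → 1+n≢n (trans (sym c≡j+1) c≡j))
                                (act-NoBoxInColumn w γ eγ (c⇒j∉ c≡j+1)))
    ... | γ , eγ , grow | no c≢j+1 = skewGrowth-¬InE grow c≢j+1 (act-¬InE w γ eγ ok)

NondecreasingBelow : ℕ → List ℕ → Set
NondecreasingBelow k w = ∀ a → a < k → nth w a ≤ nth w (suc a)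

NondecreasingBelow-tail : ∀ {k c w} → NondecreasingBelow (suc k) (c ∷ w) → NondecreasingBelow k w
NondecreasingBelow-tail mono a a<k = mono (suc a) (s≤s a<k)

∈-tail⇒≥-or-∈-drop : ∀ c w k → NondecreasingBelow (suc k) (c ∷ w) →
  ∀ {x} → x ∈ w → c ≤ x ⊎ x ∈ drop k w
∈-tail⇒≥-or-∈-drop c w zero mono x∈ = inj₂ x∈
∈-tail⇒≥-or-∈-drop c (y ∷ w) (suc k) mono (here refl) = inj₁ (mono 0 (s≤s z≤n))
∈-tail⇒≥-or-∈-drop c (y ∷ w) (suc k) mono (there x∈)
  with ∈-tail⇒≥-or-∈-drop y w k (NondecreasingBelow-tail mono) x∈
... | inj₁ y≤x = inj₁ (≤-trans (mono 0 (s≤s z≤n)) y≤x)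
... | inj₂ x∈leg = inj₂ x∈leg

NondecreasingBelow⇒NoLetterRightOfSuc : ∀ j w k → NondecreasingBelow k w → j ∉ drop k w →
  NoLetterRightOfSuc j w
NondecreasingBelow⇒NoLetterRightOfSuc j [] k mono j∉ = tt
NondecreasingBelow⇒NoLetterRightOfSuc j (c ∷ w) zero mono j∉ =
  (λ _ j∈ → j∉ (there j∈)) , NondecreasingBelow⇒NoLetterRightOfSuc j w zero (λ a ()) (λ j∈ → j∉ (there j∈))
NondecreasingBelow⇒NoLetterRightOfSuc j (c ∷ w) (suc k) mono j∉ =
  (λ { refl j∈ → excluded (∈-tail⇒≥-or-∈-drop c w k mono j∈) })
  , NondecreasingBelow⇒NoLetterRightOfSuc j w k (NondecreasingBelow-tail mono) j∉
  where
  excluded : suc j ≤ j ⊎ j ∈ drop k w → ⊥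
  excluded (inj₁ j+1≤j) = 1+n≰n j+1≤j
  excluded (inj₂ j∈leg) = j∉ j∈leg

lemma5p10 : (α β : List ℕ) (n : ℕ) → IsComposition α → IsComposition β → 1 ≤ n →
    α <c β → IsNCBorderStrip β α → skewSize β α ≡ n →
    (w : List ℕ) (k : ℕ) → IsCRHW n k w → act w α ≡ just β →
    (j : ℕ) → InE β α j → InLeg k w j
lemma5p10 α β n _ _ _ _ _ _ w k (_ , _ , (_ , arm , _) , _) e j E with j ∈? drop k w
... | yes j∈leg = j∈leg
... | no j∉leg = ⊥-elim (act-¬InE j w β e (NondecreasingBelow⇒NoLetterRightOfSuc j w k arm j∉leg) E)
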